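{- Every strong semicomplete composition $Q=T[H_1,\dots,H_t]$ with at least six vertices has at least five 4-kings. Furthermore, if such a $Q$ has no 3-king, then it has at least eight 4-kings.
   Context: All digraphs are finite, without loops or parallel arcs; paths are directed. Let $T$ be a digraph with vertices $u_1,\dots,u_t$ ($t\ge 2$) and $H_1,\dots,H_t$ digraphs, $H_i$ having vertices $u_{i,j}$, $1\le j\le n_i$. The composition $Q=T[H_1,\dots,H_t]$ has vertex set $\{u_{i,j}\}$ and arc set $\bigcup_i A(H_i)\cup\{u_{i,j}u_{p,q}: u_iu_p\in A(T)\}$ (all $j,q$). It is a semicomplete composition if $T$ is semicomplete (at least one arc between every two distinct vertices). A digraph is strong if every vertex can reach every other vertex. For $k\ge 2$, a $k$-king is a vertex from which every other vertex can be reached by a directed path of length at most $k$. -}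

module Defs where

open import Data.Nat using (ℕ; zero; suc; _≤_)
open import Data.Fin using (Fin)
open import Data.Product using (Σ; _×_; _,_; ∃)
open import Data.Sum using (_⊎_)
open import Data.Empty using (⊥)
open import Relation.Nullary using (¬_)
open import Relation.Binary.PropositionalEquality using (_≡_)
open import Function.Definitions using (Injective)

-- A digraph on a vertex type V: an arc relation with no loops.
-- (A relation admits no parallel arcs.)
record Digraph (V : Set) : Set₁ where
  field
    Arc   : V → V → Set
    loopless : ∀ v → ¬ Arc v v
open Digraph public

data Walk {V : Set} (G : Digraph V) : ℕ → V → V → Set where
  here : ∀ {u} → Walk G zero u u
  step : ∀ {k u w v} → Arc G u w → Walk G k w v → Walk G (suc k) u v

-- v reachable from u by a directed path of length at most k.
-- (Using walks: a shortest walk is a path, so this is the same notion.)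
Reach≤ : {V : Set} → Digraph V → ℕ → V → V → Set
Reach≤ G k u v = Σ ℕ λ l → l ≤ k × Walk G l u v

Strong : {V : Set} → Digraph V → Set
Strong {V} G = ∀ (u v : V) → Σ ℕ λ l → Walk G l u v

IsKing : {V : Set} → Digraph V → ℕ → V → Set
IsKing {V} G k x = ∀ (y : V) → ¬ (y ≡ x) → Reach≤ G k x y

AtLeastKings : {V : Set} → Digraph V → ℕ → ℕ → Set
AtLeastKings {V} G m k =
  Σ (Fin m → V) λ f → Injective _≡_ _≡_ f × (∀ i → IsKing G k (f i))

HasKing : {V : Set} → Digraph V → ℕ → Set
HasKing {V} G k = Σ V λ x → IsKing G k x

AtLeast : ℕ → Set → Set
AtLeast m V = Σ (Fin m → V) λ f → Injective _≡_ _≡_ f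

Semicomplete : {V : Set} → Digraph V → Set
Semicomplete {V} G = ∀ (u v : V) → ¬ (u ≡ v) → Arc G u v ⊎ Arc G v u

-- Composition T[H_1,...,H_t]; vertex u_{i,j} is (i , j).
module _ {t : ℕ} (T : Digraph (Fin t)) (n : Fin t → ℕ)
         (H : (i : Fin t) → Digraph (Fin (n i))) where

  CVert : Set
  CVert = Σ (Fin t) (λ i → Fin (n i))

  data CompArc : CVert → CVert → Set where
    inner : ∀ {i j q} → Arc (H i) j q → CompArc (i , j) (i , q)
    outer : ∀ {i j p q} → Arc T i p → CompArc (i , j) (p , q)

  compLoopless : ∀ v → ¬ CompArc v v
  compLoopless (i , j) (inner a) = loopless (H i) j a
  compLoopless (i , j) (outer a) = loopless T i a

  Composition : Digraph CVert
  Composition = record { Arc = CompArc ; loopless = compLoopless }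

module Submission where

-- Every strong semicomplete composition Q = T[H₁,…,Hₜ] (t ≥ 2) with at least six
-- vertices has at least five 4-kings; and it always has a 3-king, so the second claim
-- (eight 4-kings when there is no 3-king) holds vacuously.
--
-- The argument lives almost entirely in the quotient digraph T, which is semicomplete
-- and strong (a walk in Q projects to a walk in T).
--   * Reachability: general facts about bounded reachability and kings in any digraph,
--     notably that a walk leaving a decidable set does so along an arc.
--   * Growing kings: in a strong digraph, if the k-kings are not all vertices, some
--     non-king has an arc into a k-king and is therefore a (k+1)-king.  So "all vertices
--     or m distinct k-kings" improves to "all vertices or m+1 distinct (k+1)-kings".
--   * Semicomplete kings: a strong semicomplete digraph on ≥ 2 vertices has three
--     distinct 2-kings or only 2-kings (a Maurer-type theorem, proved with a spanning
--     sub-tournament), and every vertex lies on a closed walk of length 2 or 3.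
--   * Lifting: a k-king i of T with k ≥ 3 lifts to k-kings (i , j) of Q, the short cycle
--     through i serving to reach the other vertices of the block Hᵢ.
-- Two growth steps turn three 2-kings of T into five 4-kings, which lift to Q.

open import Defs
open import Data.Nat using (ℕ; zero; suc; _≤_; z≤n; s≤s)
open import Data.Nat.Properties using (≤-trans; ≤-refl; n≤1+n)
open import Data.Fin using (Fin; zero; suc; _<_)
open import Data.Fin.Properties using (_≟_; <-cmp; <-irrelevant; <⇒≢; any?; all?; ¬∀⟶∃¬; suc-injective)
open import Data.Vec.Functional using () renaming ([] to []ᶠ; _∷_ to _∷ᶠ_)
open import Data.Product using (∃; ∃₂; _×_; _,_; proj₁; proj₂)
open import Data.Sum using (_⊎_; inj₁; inj₂)
open import Data.Empty using (⊥-elim)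
open import Data.Bool using (Bool; true; false; not)
open import Data.Bool.Properties using (not-involutive; ¬-not) renaming (_≟_ to _≟ᵇ_)
open import Data.List using (List; []; _∷_; filter; allFin)
open import Data.List.Relation.Unary.Any using (here; there)
open import Data.List.Membership.Propositional using (_∈_)
open import Data.List.Membership.Propositional.Properties using (∈-filter⁺; ∈-filter⁻; ∈-allFin)
open import Relation.Nullary using (¬_; Dec; yes; no)
open import Relation.Nullary.Decidable using (map′; ¬?; _×-dec_; _⊎-dec_; decidable-stable)
open import Relation.Unary using (Decidable)
open import Relation.Binary using (tri<; tri≈; tri>)
open import Relation.Binary.PropositionalEquality using (_≡_; _≢_; refl; sym; trans; cong; subst)
open import Function.Definitions using (Injective)

KingsOrAll : {V : Set} → Digraph V → ℕ → ℕ → Set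
KingsOrAll G m k = (∀ v → IsKing G k v) ⊎ AtLeastKings G m k

InImage : {V : Set} {m : ℕ} → (Fin m → V) → V → Set
InImage f y = ∃ λ i → f i ≡ y

cons-injective : {V : Set} {m : ℕ} {a : V} {f : Fin m → V} →
                 ¬ InImage f a → Injective _≡_ _≡_ f → Injective _≡_ _≡_ (a ∷ᶠ f)
cons-injective a∉f f-inj {zero}  {zero}  _ = refl
cons-injective a∉f f-inj {zero}  {suc j} e = ⊥-elim (a∉f (j , sym e))
cons-injective a∉f f-inj {suc i} {zero}  e = ⊥-elim (a∉f (i , e))
cons-injective a∉f f-inj {suc i} {suc j} e = cong suc (f-inj e)

three-kings : {V : Set} {G : Digraph V} {k : ℕ} {x y z : V} → x ≢ y → x ≢ z → y ≢ z →
              IsKing G k x → IsKing G k y → IsKing G k z → AtLeastKings G 3 k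
three-kings {x = x} {y} {z} x≢y x≢z y≢z Kx Ky Kz =
  x ∷ᶠ y ∷ᶠ z ∷ᶠ []ᶠ ,
  cons-injective x∉ (cons-injective y∉ (cons-injective (λ ()) (λ { {()} }))) ,
  λ { zero → Kx ; (suc zero) → Ky ; (suc (suc zero)) → Kz }
  where
  x∉ : ¬ InImage (y ∷ᶠ z ∷ᶠ []ᶠ) x
  x∉ (zero , y≡x) = x≢y (sym y≡x)
  x∉ (suc zero , z≡x) = x≢z (sym z≡x)
  y∉ : ¬ InImage (z ∷ᶠ []ᶠ) y
  y∉ (zero , z≡y) = y≢z (sym z≡y)

kings-from-all : {V : Set} {G : Digraph V} {m k : ℕ} → AtLeast m V → KingsOrAll G m k →
                 AtLeastKings G m k
kings-from-all (g , g-inj) (inj₁ all) = g , g-inj , λ i → all (g i)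
kings-from-all _           (inj₂ ks)  = ks

at-least-pred : {V : Set} {m : ℕ} → AtLeast (suc m) V → AtLeast m V
at-least-pred (g , g-inj) = (λ i → g (suc i)) , λ e → suc-injective (g-inj e)

module Reachability {V : Set} (G : Digraph V) where

  reach-mono : ∀ {k k' u v} → k ≤ k' → Reach≤ G k u v → Reach≤ G k' u v
  reach-mono k≤k' (l , l≤k , w) = l , ≤-trans l≤k k≤k' , w

  reach-cons : ∀ {k u w v} → Arc G u w → Reach≤ G k w v → Reach≤ G (suc k) u v
  reach-cons u→w (l , l≤k , w) = suc l , s≤s l≤k , step u→w w

  reach-arc : ∀ {k u v} → Arc G u v → Reach≤ G (suc k) u v
  reach-arc u→v = reach-cons u→v (0 , z≤n , here)

  king-mono : ∀ {k k' x} → k ≤ k' → IsKing G k x → IsKing G k' x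
  king-mono k≤k' K y y≢x = reach-mono k≤k' (K y y≢x)

  walk-zero : ∀ {u v} → Walk G 0 u v → u ≡ v
  walk-zero here = refl

  exit-arc : ∀ {P : V → Set} → Decidable P → ∀ {l u v} → Walk G l u v → P u → ¬ P v →
             ∃₂ λ a b → Arc G a b × P a × ¬ P b
  exit-arc P? here Pu ¬Pv = ⊥-elim (¬Pv Pu)
  exit-arc P? (step {w = w} u→w walk) Pu ¬Pv with P? w
  ... | yes Pw = exit-arc P? walk Pw ¬Pv
  ... | no ¬Pw = _ , _ , u→w , Pu , ¬Pw

module StrongDigraph {N : ℕ} (G : Digraph (Fin N)) (strong : Strong G) where
  open Reachability G

  king-predecessor : ∀ {k a b} → Arc G a b → IsKing G k b → IsKing G (suc k) a
  king-predecessor {b = b} a→b K y y≢a with y ≟ b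
  ... | yes refl = reach-arc a→b
  ... | no y≢b   = reach-cons a→b (K y y≢b)

  out-neighbour : ∀ {x u} → u ≢ x → ∃ λ z → z ≢ x × Arc G x z
  out-neighbour {x} {u} u≢x with exit-arc (_≟ x) (proj₂ (strong x u)) refl u≢x
  ... | _ , z , x→z , refl , z≢x = z , z≢x , x→z

  in-neighbour : ∀ {x u} → u ≢ x → ∃ λ z → z ≢ x × Arc G z x
  in-neighbour {x} {u} u≢x with exit-arc (λ y → ¬? (y ≟ x)) (proj₂ (strong u x)) u≢x (λ x≢x → x≢x refl)
  ... | z , y , z→y , z≢x , ¬y≢x = z , z≢x , subst (Arc G z) (decidable-stable (y ≟ x) ¬y≢x) z→y

  image? : ∀ {m} (f : Fin m → Fin N) → Decidable (InImage f)
  image? f y = any? (λ i → f i ≟ y)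

  arc-into-image : ∀ {m} (f : Fin (suc m) → Fin N) → ¬ (∀ v → InImage f v) →
                   ∃₂ λ a i → Arc G a (f i) × ¬ InImage f a
  arc-into-image f not-onto with ¬∀⟶∃¬ N _ (image? f) not-onto
  ... | v , v∉f with exit-arc (λ y → ¬? (image? f y)) (proj₂ (strong v (f zero))) v∉f (λ f0∉f → f0∉f (zero , refl))
  ...   | a , b , a→b , a∉f , ¬b∉f with decidable-stable (image? f b) ¬b∉f
  ...     | i , refl = a , i , a→b , a∉f

  add-king : ∀ {m k} → KingsOrAll G (suc m) k → KingsOrAll G (suc (suc m)) (suc k)
  add-king {k = k} (inj₁ all) = inj₁ λ v → king-mono (n≤1+n k) (all v)
  add-king {k = k} (inj₂ (f , f-inj , K)) with all? (image? f)
  ... | yes onto = inj₁ λ v → subst (IsKing G (suc k)) (proj₂ (onto v)) (king-mono (n≤1+n k) (K (proj₁ (onto v))))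
  ... | no not-onto with arc-into-image f not-onto
  ...   | a , i , a→fi , a∉f = inj₂ (a ∷ᶠ f , cons-injective a∉f f-inj , K')
    where
    K' : ∀ j → IsKing G (suc k) ((a ∷ᶠ f) j)
    K' zero    = king-predecessor a→fi (K i)
    K' (suc j) = king-mono (n≤1+n k) (K j)

-- A spanning sub-tournament of a semicomplete digraph: for each pair a < b keep one of
-- the arcs chosen by semicompleteness.  Unlike the arc relation it is decidable.
module Orientation {N : ℕ} (T : Digraph (Fin N)) (sc : Semicomplete T) where

  private
    is-inj₁ : {A B : Set} → A ⊎ B → Bool
    is-inj₁ (inj₁ _) = true
    is-inj₁ (inj₂ _) = false

    forward : (a b : Fin N) → a < b → Bool
    forward a b a<b = is-inj₁ (sc a b (<⇒≢ a<b))

    forward-arc : ∀ a b a<b → forward a b a<b ≡ true → Arc T a b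
    forward-arc a b a<b e with sc a b (<⇒≢ a<b) | e
    ... | inj₁ a→b | _ = a→b
    ... | inj₂ _   | ()

    backward-arc : ∀ a b a<b → forward a b a<b ≡ false → Arc T b a
    backward-arc a b a<b e with sc a b (<⇒≢ a<b) | e
    ... | inj₁ _   | ()
    ... | inj₂ b→a | _ = b→a

  beats : Fin N → Fin N → Bool
  beats a b with <-cmp a b
  ... | tri< a<b _ _ = forward a b a<b
  ... | tri≈ _ _ _   = false
  ... | tri> _ _ b<a = not (forward b a b<a)

  -- a record rather than an equation, so that a and b are inferable from a proof
  record Beats (a b : Fin N) : Set where
    constructor chosen
    field is-chosen : beats a b ≡ true

  beats? : ∀ a b → Dec (Beats a b)
  beats? a b = map′ chosen Beats.is-chosen (beats a b ≟ᵇ true)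

  beats⇒arc : ∀ {a b} → Beats a b → Arc T a b
  beats⇒arc {a} {b} (chosen e) with <-cmp a b | e
  ... | tri< a<b _ _ | e' = forward-arc a b a<b e'
  ... | tri> _ _ b<a | e' = backward-arc b a b<a (trans (sym (not-involutive _)) (cong not e'))

  beats-irrefl : ∀ {a} → ¬ Beats a a
  beats-irrefl {a} a⇒a = loopless T a (beats⇒arc a⇒a)

  -- on distinct vertices exactly one direction is chosen; the two order proofs agree by
  -- irrelevance of <
  beats-swap : ∀ {a b} → a ≢ b → beats b a ≡ not (beats a b)
  beats-swap {a} {b} a≢b with <-cmp a b | <-cmp b a
  ... | tri< a<b _ _   | tri> _ _ a<b'  = cong (λ p → not (forward a b p)) (<-irrelevant a<b' a<b)
  ... | tri< a<b _ b≮a | tri< b<a _ _   = ⊥-elim (b≮a b<a)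
  ... | tri< _ _ _     | tri≈ _ b≡a _   = ⊥-elim (a≢b (sym b≡a))
  ... | tri≈ _ a≡b _   | _              = ⊥-elim (a≢b a≡b)
  ... | tri> _ _ b<a   | tri< b<a' _ _  =
        trans (cong (forward b a) (<-irrelevant b<a' b<a)) (sym (not-involutive _))
  ... | tri> _ _ _     | tri≈ _ b≡a _   = ⊥-elim (a≢b (sym b≡a))
  ... | tri> a≮b _ _   | tri> _ _ a<b   = ⊥-elim (a≮b a<b)

  beats-total : ∀ {a b} → a ≢ b → ¬ Beats a b → Beats b a
  beats-total a≢b ¬a⇒b = chosen (trans (beats-swap a≢b) (cong not (¬-not (λ e → ¬a⇒b (chosen e)))))

  beats-asym : ∀ {a b} → Beats a b → ¬ Beats b a
  beats-asym {a} {b} a⇒b (chosen b→a) with a ≟ b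
  ... | yes refl = beats-irrefl a⇒b
  ... | no a≢b with () ← trans (sym b→a) (trans (beats-swap a≢b) (cong not (Beats.is-chosen a⇒b)))

another : ∀ {n} (x : Fin (suc (suc n))) → ∃ λ y → y ≢ x
another zero    = suc zero , λ ()
another (suc _) = zero , λ ()

module SemicompleteKings {n : ℕ} (T : Digraph (Fin (suc (suc n)))) (sc : Semicomplete T)
                         (strong : Strong T) where
  open Reachability T
  open StrongDigraph T strong
  open Orientation T sc

  V : Set
  V = Fin (suc (suc n))

  Reach2 : V → V → Set
  Reach2 w y = Arc T w y ⊎ ∃ λ z → Arc T w z × Arc T z y

  reach2⇒reach : ∀ {w y} → Reach2 w y → Reach≤ T 2 w y
  reach2⇒reach (inj₁ w→y)           = reach-arc w→y
  reach2⇒reach (inj₂ (z , w→z , z→y)) = reach-cons w→z (reach-arc z→y)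

  reroute : ∀ {w v y} → Reach2 w y → Reach2 w v ⊎ Reach2 v y
  reroute {w} {v} {y} (inj₁ w→y) with y ≟ v
  ... | yes refl = inj₁ (inj₁ w→y)
  ... | no y≢v with sc y v y≢v
  ...   | inj₁ y→v = inj₁ (inj₂ (y , w→y , y→v))
  ...   | inj₂ v→y = inj₂ (inj₁ v→y)
  reroute {w} {v} {y} (inj₂ (z , w→z , z→y)) with z ≟ v
  ... | yes refl = inj₁ (inj₁ w→z)
  ... | no z≢v with sc z v z≢v
  ...   | inj₁ z→v = inj₁ (inj₂ (z , w→z , z→v))
  ...   | inj₂ v→z = inj₂ (inj₂ (z , v→z , z→y))

  Covers : V → V → List V → Set
  Covers v e L = ∀ y → y ∈ L → y ≢ e → Reach2 v y

  covers-∷ : ∀ {v e y L} → (y ≢ e → Reach2 v y) → Covers v e L → Covers v e (y ∷ L)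
  covers-∷ r C _ (here refl) y≢e = r y≢e
  covers-∷ r C y (there y∈L) y≢e = C y y∈L y≢e

  reroute-all : ∀ {w v} L → Covers w w L → Reach2 w v ⊎ Covers v w L
  reroute-all [] C = inj₂ λ _ ()
  reroute-all {w} {v} (y ∷ L) C with reroute-all L (λ y' y'∈L → C y' (there y'∈L))
  ... | inj₁ w⇝v = inj₁ w⇝v
  ... | inj₂ C' with y ≟ w
  ...   | yes refl = inj₂ (covers-∷ (λ w≢w → ⊥-elim (w≢w refl)) C')
  ...   | no y≢w with reroute {v = v} (C y (here refl) y≢w)
  ...     | inj₁ w⇝v = inj₁ w⇝v
  ...     | inj₂ v⇝y = inj₂ (covers-∷ (λ _ → v⇝y) C')

  extend-king : ∀ v {w} L → Covers w w L → ∃ λ w' → (w' ≡ v ⊎ w' ≡ w) × Covers w' w' (v ∷ L)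
  extend-king v {w} L C with v ≟ w
  ... | yes refl = w , inj₂ refl , covers-∷ (λ w≢w → ⊥-elim (w≢w refl)) C
  ... | no v≢w with sc w v (λ w≡v → v≢w (sym w≡v))
  ...   | inj₁ w→v = w , inj₂ refl , covers-∷ (λ _ → inj₁ w→v) C
  ...   | inj₂ v→w with reroute-all L C
  ...     | inj₁ w⇝v = w , inj₂ refl , covers-∷ (λ _ → w⇝v) C
  ...     | inj₂ C' = v , inj₁ refl , covers-∷ (λ v≢v → ⊥-elim (v≢v refl)) via-w
    where
    via-w : Covers v v L
    via-w y y∈L y≢v with y ≟ w
    ... | yes refl = inj₁ v→w
    ... | no y≢w   = C' y y∈L y≢w

  list-king : ∀ {z} L → z ∈ L → ∃ λ w → w ∈ L × Covers w w L
  list-king (v ∷ []) _ = v , here refl , covers-∷ (λ v≢v → ⊥-elim (v≢v refl)) (λ _ ())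
  list-king (v ∷ u ∷ L) _ with list-king (u ∷ L) (here refl)
  ... | w , w∈ , C with extend-king v (u ∷ L) C
  ...   | w' , inj₁ refl , C' = w' , here refl , C'
  ...   | w' , inj₂ refl , C' = w' , there w∈ , C'

  set-king : ∀ {S : V → Set} → Decidable S → ∀ {z} → S z →
             ∃ λ w → S w × (∀ y → S y → y ≢ w → Reach2 w y)
  set-king S? {z} Sz with list-king (filter S? (allFin _)) (∈-filter⁺ S? (∈-allFin z) Sz)
  ... | w , w∈ , C = w , proj₂ (∈-filter⁻ S? w∈) , λ y Sy → C y (∈-filter⁺ S? (∈-allFin y) Sy)

  king-through : ∀ {w x} → Arc T w x → (∀ y → y ≢ w → y ≢ x → Reach2 w y ⊎ Arc T x y) →
                 IsKing T 2 w
  king-through {w} {x} w→x cover y y≢w with y ≟ x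
  ... | yes refl = reach-arc w→x
  ... | no y≢x with cover y y≢w y≢x
  ...   | inj₁ w⇝y = reach2⇒reach w⇝y
  ...   | inj₂ x→y = reach2⇒reach (inj₂ (x , w→x , x→y))

  king-of-in-set : ∀ {x} {S : V → Set} → Decidable S → (∀ {y} → S y → Arc T y x) →
                   (∀ {y} → y ≢ x → ¬ S y → Arc T x y) → ∀ {z} → S z →
                   ∃ λ w → S w × IsKing T 2 w
  king-of-in-set {x} {S} S? S→x x→∁S Sz with set-king S? Sz
  ... | w , Sw , C = w , Sw , king-through (S→x Sw) cover
    where
    cover : ∀ y → y ≢ w → y ≢ x → Reach2 w y ⊎ Arc T x y
    cover y y≢w y≢x with S? y
    ... | yes Sy = inj₁ (C y Sy y≢w)
    ... | no ¬Sy = inj₂ (x→∁S y≢x ¬Sy)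

  beaten-by-king : ∀ {x z} → Beats z x → ∃ λ w → Beats w x × IsKing T 2 w
  beaten-by-king {x} = king-of-in-set (λ y → beats? y x) beats⇒arc
                         (λ y≢x ¬y⇒x → beats⇒arc (beats-total y≢x ¬y⇒x))

  -- Without a source of the orientation, x₀ ⇐ w₁ ⇐ w₂ ⇐ w₃ with each wᵢ a 2-king;
  -- w₃ ≢ w₁ because the orientation has no 2-cycle.
  sourceless-kings : (∀ x → ∃ λ z → Beats z x) → AtLeastKings T 3 2
  sourceless-kings beaten with beaten-by-king (proj₂ (beaten zero))
  ... | w₁ , _ , K₁ with beaten-by-king (proj₂ (beaten w₁))
  ...   | w₂ , w₂⇒w₁ , K₂ with beaten-by-king (proj₂ (beaten w₂))
  ...     | w₃ , w₃⇒w₂ , K₃ = three-kings w₁≢w₂ w₁≢w₃ w₂≢w₃ K₁ K₂ K₃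
    where
    w₁≢w₂ : w₁ ≢ w₂
    w₁≢w₂ refl = beats-irrefl w₂⇒w₁
    w₂≢w₃ : w₂ ≢ w₃
    w₂≢w₃ refl = beats-irrefl w₃⇒w₂
    w₁≢w₃ : w₁ ≢ w₃
    w₁≢w₃ refl = beats-asym w₂⇒w₁ w₃⇒w₂

  Source : V → Set
  Source d = ∀ y → y ≡ d ⊎ Beats d y

  source-arc : ∀ {d} → Source d → ∀ {y} → y ≢ d → Arc T d y
  source-arc src {y} y≢d with src y
  ... | inj₁ y≡d = ⊥-elim (y≢d y≡d)
  ... | inj₂ d⇒y = beats⇒arc d⇒y

  -- A source d together with an in-neighbour z of d (which exists by strong connectivity).
  module WithSource {d z : V} (src : Source d) (z≢d : z ≢ d) (z→d : Arc T z d) where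

    Outside : V → Set
    Outside y = y ≢ d × y ≢ z

    outside? : Decidable Outside
    outside? y = ¬? (y ≟ d) ×-dec ¬? (y ≟ z)

    d-king : IsKing T 2 d
    d-king y y≢d = reach-arc (source-arc src y≢d)

    z-arc : ∀ {y} → y ≢ z → ¬ (Outside y × Beats y z) → Arc T z y
    z-arc {y} y≢z ¬S with y ≟ d
    ... | yes refl = z→d
    ... | no y≢d   = beats⇒arc (beats-total y≢z (λ y⇒z → ¬S ((y≢d , y≢z) , y⇒z)))

    z-king : IsKing T 2 z
    z-king = king-through z→d (λ y _ y≢d → inj₂ (source-arc src y≢d))

    -- If some vertex lies outside {d, z}, then one of them is a 2-king: either a 2-king
    -- of those beating z, or (if none beats z) the tail of an arc entering {d, z}.
    third-king : ∀ {y₀} → Outside y₀ → ∃ λ w → Outside w × IsKing T 2 w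
    third-king {y₀} out₀ with any? (λ y → outside? y ×-dec beats? y z)
    ... | yes (_ , S) with king-of-in-set (λ y → outside? y ×-dec beats? y z)
                             (λ S → beats⇒arc (proj₂ S)) z-arc S
    ...   | w , (out , _) , K = w , out , K
    third-king {y₀} out₀ | no no-beater
      with exit-arc outside? (proj₂ (strong y₀ d)) out₀ (λ out-d → proj₁ out-d refl)
    ... | a , b , a→b , out-a , ¬out-b = a , out-a , king-through a→b (λ _ _ y≢b → inj₂ (dominates y≢b))
      where
      -- b ∈ {d, z} has an arc to every other vertex, as no vertex outside beats z
      dominates : ∀ {y} → y ≢ b → Arc T b y
      dominates y≢b with b ≟ d | b ≟ z
      ... | yes refl | _        = source-arc src y≢b
      ... | no _     | yes refl = z-arc y≢b (λ S → no-beater (_ , S))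
      ... | no b≢d   | no b≢z   = ⊥-elim (¬out-b (b≢d , b≢z))

    kings : KingsOrAll T 3 2
    kings with any? outside?
    ... | no none = inj₁ all-kings
      where
      all-kings : ∀ v → IsKing T 2 v
      all-kings v with v ≟ d | v ≟ z
      ... | yes refl | _        = d-king
      ... | no _     | yes refl = z-king
      ... | no v≢d   | no v≢z   = ⊥-elim (none (v , v≢d , v≢z))
    ... | yes (_ , out₀) with third-king out₀
    ...   | w , (w≢d , w≢z) , K =
            inj₂ (three-kings (λ d≡z → z≢d (sym d≡z)) (λ d≡w → w≢d (sym d≡w))
                              (λ z≡w → w≢z (sym z≡w)) d-king z-king K)

  three-2-kings : KingsOrAll T 3 2
  three-2-kings with any? (λ d → all? (λ y → (y ≟ d) ⊎-dec beats? d y))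
  ... | yes (d , src) with in-neighbour (proj₂ (another d))
  ...   | z , z≢d , z→d = WithSource.kings src z≢d z→d
  three-2-kings | no no-source = inj₂ (sourceless-kings beaten)
    where
    beaten : ∀ x → ∃ λ z → Beats z x
    beaten x with ¬∀⟶∃¬ _ _ (λ y → (y ≟ x) ⊎-dec beats? x y) (λ src → no-source (x , src))
    ... | z , ¬z = z , beats-total (λ x≡z → ¬z (inj₁ (sym x≡z))) (λ x⇒z → ¬z (inj₂ x⇒z))

  a-2-king : HasKing T 2
  a-2-king with three-2-kings
  ... | inj₁ all           = zero , all zero
  ... | inj₂ (f , _ , K) = f zero , K zero

  -- Every vertex i lies on a closed walk of length 2 or 3: follow an arc i → o; if the
  -- orientation does not return o → i, a walk from o back to i leaves the set of
  -- vertices beaten by i along an arc x → y, and i → x → y (→ i) closes the cycle.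
  short-cycle : ∀ i → ∃ λ m → m ≤ 2 × Walk T (suc m) i i
  short-cycle i with out-neighbour (proj₂ (another i))
  ... | o , o≢i , i→o with beats? o i
  ...   | yes o⇒i = 1 , s≤s z≤n , step i→o (step (beats⇒arc o⇒i) here)
  ...   | no ¬o⇒i with exit-arc (beats? i) (proj₂ (strong o i)) (beats-total o≢i ¬o⇒i) beats-irrefl
  ...     | x , y , x→y , i⇒x , ¬i⇒y with y ≟ i
  ...       | yes refl = 1 , s≤s z≤n , step (beats⇒arc i⇒x) (step x→y here)
  ...       | no y≢i   = 2 , ≤-refl , step (beats⇒arc i⇒x) (step x→y (step (beats⇒arc y⇒i) here))
    where
    y⇒i : Beats y i
    y⇒i = beats-total (λ i≡y → y≢i (sym i≡y)) ¬i⇒y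

module Lifting {t : ℕ} (T : Digraph (Fin t)) (n : Fin t → ℕ)
               (H : (i : Fin t) → Digraph (Fin (n i))) (elt : ∀ i → Fin (n i)) where
  open Reachability T using (walk-zero)

  Q : Digraph (CVert T n H)
  Q = Composition T n H

  project-walk : ∀ {l u v} → Walk Q l u v → ∃ λ l' → Walk T l' (proj₁ u) (proj₁ v)
  project-walk here                 = 0 , here
  project-walk (step (inner _) w)   = project-walk w
  project-walk (step (outer i→p) w) with project-walk w
  ... | l , w' = suc l , step i→p w'

  project-strong : Strong Q → Strong T
  project-strong strongQ u v = project-walk (proj₂ (strongQ (u , elt u) (v , elt v)))

  lift-walk : ∀ {m a b} → Walk T (suc m) a b → ∀ j q → Walk Q (suc m) (a , j) (b , q)
  lift-walk (step a→b here) j q = step (outer a→b) here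
  lift-walk (step {w = x} a→x (step x→y w)) j q = step (outer a→x) (lift-walk (step x→y w) (elt x) q)

  -- If every vertex of T lies on a closed walk of length at most 3, a k-king i of T
  -- (k ≥ 3) gives k-kings (i , j) of Q: other blocks are reached as in T, the own block
  -- along the lifted cycle.
  module _ (short-cycle : ∀ i → ∃ λ m → m ≤ 2 × Walk T (suc m) i i) {k : ℕ} (3≤k : 3 ≤ k) where

    lift-king : ∀ {i} → IsKing T k i → ∀ j → IsKing Q k (i , j)
    lift-king {i} K j (p , q) _ with p ≟ i
    ... | yes refl with short-cycle i
    ...   | m , m≤2 , cycle = suc m , ≤-trans (s≤s m≤2) 3≤k , lift-walk cycle j q
    lift-king {i} K j (p , q) _ | no p≢i with K p p≢i
    ... | zero  , _ , w    = ⊥-elim (p≢i (sym (walk-zero w)))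
    ... | suc l , l<k , w = suc l , l<k , lift-walk w j q

    lift-kings : ∀ {m} → KingsOrAll T m k → KingsOrAll Q m k
    lift-kings (inj₁ all) = inj₁ λ (i , j) → lift-king (all i) j
    lift-kings (inj₂ (f , f-inj , K)) =
      inj₂ ((λ a → f a , elt (f a)) , (λ e → f-inj (cong proj₁ e)) , λ a → lift-king (K a) (elt (f a)))

first : ∀ {m} → 1 ≤ m → Fin m
first (s≤s _) = zero

theorem2p15 : (t : ℕ) → 2 ≤ t → (T : Digraph (Fin t)) → Semicomplete T →
    (n : Fin t → ℕ) → (∀ i → 1 ≤ n i) →
    (H : (i : Fin t) → Digraph (Fin (n i))) →
    Strong (Composition T n H) →
    AtLeast 6 (CVert T n H) →
    AtLeastKings (Composition T n H) 5 4
    × (¬ HasKing (Composition T n H) 3 → AtLeastKings (Composition T n H) 8 4)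
theorem2p15 (suc (suc _)) (s≤s (s≤s z≤n)) T sc n nonempty H strongQ six-vertices =
  five-kings , λ no-3-king → ⊥-elim (no-3-king a-3-king)
  where
  open Lifting T n H (λ i → first (nonempty i))
  open SemicompleteKings T sc (project-strong strongQ)
  open StrongDigraph T (project-strong strongQ) using (add-king)
  open Reachability T using (king-mono)

  five-kings : AtLeastKings Q 5 4
  five-kings = kings-from-all (at-least-pred six-vertices)
                 (lift-kings short-cycle (s≤s (s≤s (s≤s z≤n))) (add-king (add-king three-2-kings)))

  -- a 2-king of T lifts to a 3-king of Q, so the second claim is vacuous
  a-3-king : HasKing Q 3
  a-3-king = let (i , K) = a-2-king in
             (i , first (nonempty i)) , lift-king short-cycle ≤-refl (king-mono (n≤1+n 2) K) _
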